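{- Let $V_n$ be the approximating graphs of the Diamond fractal (defined in the context), with vertex degrees $d_1,\dots,d_{|V_n|}$. Then for all $n\ge1$, $$\frac{\prod_{i=1}^{|V_n|}d_i}{\sum_{i=1}^{|V_n|}d_i}=2^{\frac19(2\cdot4^{n+1}-6n-17)}.$$
   Context: $V_0$ is a single edge joining two vertices $x_1,x_2$. For $n\ge1$, $V_n$ is obtained from $V_{n-1}$ by replacing each edge $\{u,v\}$ by a "diamond": two new vertices $a,b$ (distinct for different edges) and the four edges $ua,av,vb,bu$, the edge $\{u,v\}$ itself being removed. Thus $V_1$ is a 4-cycle. -}

module Defs where

open import Data.Nat using (ℕ; zero; suc; _+_; _*_; _≡ᵇ_)
open import Data.Bool using (if_then_else_)
open import Data.List using (List; []; _∷_; [_]; length; map; upTo)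
open import Data.Nat.ListAction using (sum; product)
open import Data.Product using (_×_; _,_)

-- A finite graph with vertex set {0, …, nv - 1} given by its list of edges.
record Graph : Set where
  constructor mkGraph
  field
    nv    : ℕ
    edges : List (ℕ × ℕ)
open Graph public

diamondEdges : ℕ → List (ℕ × ℕ) → List (ℕ × ℕ)
diamondEdges k [] = []
diamondEdges k ((u , v) ∷ es) =
  (u , k) ∷ (k , v) ∷ (v , suc k) ∷ (suc k , u) ∷ diamondEdges (suc (suc k)) es

-- The approximating graphs V_n of the Diamond fractal (x₁ = 0, x₂ = 1).
V : ℕ → Graph
V zero    = mkGraph 2 [ (0 , 1) ]
V (suc n) = mkGraph (nv (V n) + 2 * length (edges (V n)))
                    (diamondEdges (nv (V n)) (edges (V n)))

-- number of endpoints of edge e equal to x (graphs here have no loops)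
incidence : ℕ → ℕ × ℕ → ℕ
incidence x (u , v) = (if x ≡ᵇ u then 1 else 0) + (if x ≡ᵇ v then 1 else 0)

degree : Graph → ℕ → ℕ
degree G x = sum (map (incidence x) (edges G))

degrees : Graph → List ℕ
degrees G = map (degree G) (upTo (nv G))

-- Replacing every edge of a graph G (vertices 0 … N-1, edges all below N) by a
-- diamond on two fresh vertices has a simple effect on degrees: every old vertex
-- has its degree doubled (each edge uv becomes the paths u-a-v and u-b-v), and
-- each of the 2·|E| fresh vertices has degree 2.  Hence the degree list of the
-- new graph is  map (2 *_) (degrees G) ++ replicate (2|E|) 2,  so
--   sum     ↦ 2·sum + 4|E|,        product ↦ 2^N · product · 2^(2|E|).  For n = m+1 the exponent e_m of  product = 2^e · sum  obeys the
-- recursion e_{m+1} = e_m + F_{m+1} + 2·4^{m+1}, and a short computation gives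
-- 9·e_m + 6(m+1) + 17 = 8·4^{m+1} = 2·4^{m+2}, which is the corollary.

module Submission where

open import Defs
open import Data.Nat using (ℕ; zero; suc; _+_; _*_; _^_; _≤_; _<_; _≡ᵇ_; z≤n; s≤s)
open import Data.Nat.Properties
  using (≤-refl; ≤-trans; <-trans; <-≤-trans; ≤-pred; <⇒≢; >⇒≢; m<n⇒m<1+n; n<1+n; n≤1+n;
         m≤m+n; +-identityʳ; +-suc; +-comm; *-suc; *-zeroʳ; *-distribˡ-+; ^-distribˡ-+-*)
open import Data.Nat.ListAction using (sum; product)
open import Data.Nat.ListAction.Properties using (sum-++; product-++)
open import Data.Nat.Tactic.RingSolver using (solve-∀)
open import Data.Bool using (false; if_then_else_)
open import Data.Empty using (⊥-elim)
open import Data.List using (List; []; _∷_; _++_; length; map; replicate; upTo; applyUpTo)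
open import Data.List.Properties using (map-++; map-∘; map-cong-local; map-upTo; length-map; length-upTo)
open import Data.List.Relation.Unary.All as All using (All; []; _∷_)
open import Data.List.Relation.Unary.All.Properties using (all-upTo)
open import Data.Product using (Σ; _×_; _,_; proj₁; proj₂)
open import Function using (_∘_)
open import Relation.Binary.PropositionalEquality
  using (_≡_; _≢_; refl; sym; trans; cong; cong₂; subst; module ≡-Reasoning)

open ≡-Reasoning

sum-map-* : ∀ c xs → sum (map (c *_) xs) ≡ c * sum xs
sum-map-* c []       = sym (*-zeroʳ c)
sum-map-* c (x ∷ xs) =
  trans (cong (c * x +_) (sum-map-* c xs)) (sym (*-distribˡ-+ c x (sum xs)))

product-map-* : ∀ c xs → product (map (c *_) xs) ≡ c ^ length xs * product xs
product-map-* c []       = refl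
product-map-* c (x ∷ xs) = begin
  c * x * product (map (c *_) xs)      ≡⟨ cong (c * x *_) (product-map-* c xs) ⟩
  c * x * (c ^ length xs * product xs) ≡⟨ swap c x (c ^ length xs) (product xs) ⟩
  c * c ^ length xs * (x * product xs) ∎
  where
  swap : ∀ c x p q → c * x * (p * q) ≡ c * p * (x * q)
  swap = solve-∀

sum-replicate : ∀ n c → sum (replicate n c) ≡ n * c
sum-replicate zero    c = refl
sum-replicate (suc n) c = cong (c +_) (sum-replicate n c)

product-replicate : ∀ n c → product (replicate n c) ≡ c ^ n
product-replicate zero    c = refl
product-replicate (suc n) c = cong (c *_) (product-replicate n c)

map-const : ∀ {A B : Set} (c : B) (xs : List A) → map (λ _ → c) xs ≡ replicate (length xs) c
map-const c []       = refl
map-const c (x ∷ xs) = cong (c ∷_) (map-const c xs)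

applyUpTo-+ : ∀ {A : Set} (f : ℕ → A) a b →
              applyUpTo f (a + b) ≡ applyUpTo f a ++ applyUpTo (f ∘ (a +_)) b
applyUpTo-+ f zero    b = refl
applyUpTo-+ f (suc a) b = cong (f 0 ∷_) (applyUpTo-+ (f ∘ suc) a b)

upTo-+ : ∀ a b → upTo (a + b) ≡ upTo a ++ map (a +_) (upTo b)
upTo-+ a b = trans (applyUpTo-+ (λ i → i) a b) (cong (upTo a ++_) (sym (map-upTo (a +_) b)))

≢⇒≡ᵇ-false : ∀ {x y} → x ≢ y → (x ≡ᵇ y) ≡ false
≢⇒≡ᵇ-false {zero}  {zero}  x≢y = ⊥-elim (x≢y refl)
≢⇒≡ᵇ-false {zero}  {suc y} x≢y = refl
≢⇒≡ᵇ-false {suc x} {zero}  x≢y = refl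
≢⇒≡ᵇ-false {suc x} {suc y} x≢y = ≢⇒≡ᵇ-false (x≢y ∘ cong suc)

incidence-absent : ∀ {x u v} → x ≢ u → x ≢ v → incidence x (u , v) ≡ 0
incidence-absent x≢u x≢v rewrite ≢⇒≡ᵇ-false x≢u | ≢⇒≡ᵇ-false x≢v = refl

incidence-left : ∀ k → incidence k (k , suc k) ≡ 1
incidence-left zero    = refl
incidence-left (suc k) = incidence-left k

incidence-right : ∀ k → incidence (suc k) (k , suc k) ≡ 1
incidence-right zero    = refl
incidence-right (suc k) = incidence-right k

EdgesBelow : ℕ → List (ℕ × ℕ) → Set
EdgesBelow k = All (λ e → proj₁ e < k × proj₂ e < k)

edgesBelow-mono : ∀ {k k′} {es} → k ≤ k′ → EdgesBelow k es → EdgesBelow k′ es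
edgesBelow-mono k≤k′ = All.map (λ { (u<k , v<k) → <-≤-trans u<k k≤k′ , <-≤-trans v<k k≤k′ })

edgeDegree : ℕ → List (ℕ × ℕ) → ℕ
edgeDegree x es = sum (map (incidence x) es)

edgeDegree-beyond : ∀ {k x} es → EdgesBelow k es → k ≤ x → edgeDegree x es ≡ 0
edgeDegree-beyond []             []                  k≤x = refl
edgeDegree-beyond ((u , v) ∷ es) ((u<k , v<k) ∷ below) k≤x =
  cong₂ _+_ (incidence-absent (>⇒≢ (<-≤-trans u<k k≤x)) (>⇒≢ (<-≤-trans v<k k≤x)))
            (edgeDegree-beyond es below k≤x)

diamondEdges-length : ∀ k es → length (diamondEdges k es) ≡ 4 * length es
diamondEdges-length k []       = refl
diamondEdges-length k (e ∷ es) =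
  trans (cong (4 +_) (diamondEdges-length (suc (suc k)) es)) (sym (*-suc 4 (length es)))

diamondEdges-below : ∀ {k k′} es → EdgesBelow k es → k + 2 * length es ≤ k′ →
                     EdgesBelow k′ (diamondEdges k es)
diamondEdges-below []             []                    bound = []
diamondEdges-below {k} {k′} ((u , v) ∷ es) ((u<k , v<k) ∷ below) bound =
    (u<k′ , k<k′) ∷ (k<k′ , v<k′) ∷ (v<k′ , 1+k<k′) ∷ (1+k<k′ , u<k′)
  ∷ diamondEdges-below es (edgesBelow-mono (≤-trans (n≤1+n k) (n≤1+n (suc k))) below) rest-bound
  where
  shift : ∀ k l → k + 2 * suc l ≡ suc (suc k) + 2 * l
  shift = solve-∀
  rest-bound : suc (suc k) + 2 * length es ≤ k′
  rest-bound = subst (_≤ k′) (shift k (length es)) bound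
  1+k<k′ : suc k < k′
  1+k<k′ = ≤-trans (m≤m+n (suc (suc k)) _) rest-bound
  k<k′ : k < k′
  k<k′ = <-trans (n<1+n k) 1+k<k′
  u<k′ : u < k′
  u<k′ = <-trans u<k k<k′
  v<k′ : v < k′
  v<k′ = <-trans v<k k<k′

diamond-block : ∀ x k u v es →
  edgeDegree x (diamondEdges k ((u , v) ∷ es)) ≡
  2 * incidence x (u , v) + 2 * incidence x (k , suc k) + edgeDegree x (diamondEdges (suc (suc k)) es)
diamond-block x k u v es =
  regroup (if-eq x u) (if-eq x v) (if-eq x k) (if-eq x (suc k))
          (edgeDegree x (diamondEdges (suc (suc k)) es))
  where
  if-eq : ℕ → ℕ → ℕ
  if-eq x y = if x ≡ᵇ y then 1 else 0
  regroup : ∀ a b c d r → (a + c) + ((c + b) + ((b + d) + ((d + a) + r))) ≡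
                          2 * (a + b) + 2 * (c + d) + r
  regroup = solve-∀

diamond-old-degree : ∀ {k x} es → x < k → edgeDegree x (diamondEdges k es) ≡ 2 * edgeDegree x es
diamond-old-degree             []             x<k = refl
diamond-old-degree {k} {x} ((u , v) ∷ es) x<k = begin
  edgeDegree x (diamondEdges k ((u , v) ∷ es))
    ≡⟨ diamond-block x k u v es ⟩
  2 * incidence x (u , v) + 2 * incidence x (k , suc k) + edgeDegree x (diamondEdges (suc (suc k)) es)
    ≡⟨ cong₂ (λ i d → 2 * incidence x (u , v) + 2 * i + d)
             (incidence-absent (<⇒≢ x<k) (<⇒≢ (m<n⇒m<1+n x<k)))
             (diamond-old-degree es (m<n⇒m<1+n (m<n⇒m<1+n x<k))) ⟩
  2 * incidence x (u , v) + 2 * 0 + 2 * edgeDegree x es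
    ≡⟨ collect (incidence x (u , v)) (edgeDegree x es) ⟩
  2 * (incidence x (u , v) + edgeDegree x es) ∎
  where
  collect : ∀ a d → 2 * a + 2 * 0 + 2 * d ≡ 2 * (a + d)
  collect = solve-∀

diamond-block-fresh : ∀ {k u v x} es → u < k → v < k → k ≤ x →
  edgeDegree x (diamondEdges k ((u , v) ∷ es)) ≡
  2 * incidence x (k , suc k) + edgeDegree x (diamondEdges (suc (suc k)) es)
diamond-block-fresh {k} {u} {v} {x} es u<k v<k k≤x =
  trans (diamond-block x k u v es)
        (cong (λ i → 2 * i + 2 * incidence x (k , suc k) + edgeDegree x (diamondEdges (suc (suc k)) es))
              (incidence-absent (>⇒≢ (<-≤-trans u<k k≤x)) (>⇒≢ (<-≤-trans v<k k≤x))))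

diamond-first-fresh : ∀ {k u v x} es → u < k → v < k → EdgesBelow k es →
  k ≤ x → x < suc (suc k) → incidence x (k , suc k) ≡ 1 →
  edgeDegree x (diamondEdges k ((u , v) ∷ es)) ≡ 2
diamond-first-fresh {k} {u} {v} {x} es u<k v<k below k≤x x<k+2 hit = begin
  edgeDegree x (diamondEdges k ((u , v) ∷ es))
    ≡⟨ diamond-block-fresh es u<k v<k k≤x ⟩
  2 * incidence x (k , suc k) + edgeDegree x (diamondEdges (suc (suc k)) es)
    ≡⟨ cong₂ (λ i d → 2 * i + d) hit (diamond-old-degree es x<k+2) ⟩
  2 + 2 * edgeDegree x es
    ≡⟨ cong (λ d → 2 + 2 * d) (edgeDegree-beyond es below k≤x) ⟩
  2 ∎

diamond-fresh-degree : ∀ {k} es → EdgesBelow k es → ∀ i → i < 2 * length es →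
                       edgeDegree (k + i) (diamondEdges k es) ≡ 2
diamond-fresh-degree {k} ((u , v) ∷ es) ((u<k , v<k) ∷ below) zero _ =
  subst (λ x → edgeDegree x (diamondEdges k ((u , v) ∷ es)) ≡ 2) (sym (+-identityʳ k))
        (diamond-first-fresh es u<k v<k below ≤-refl (m<n⇒m<1+n (n<1+n k)) (incidence-left k))
diamond-fresh-degree {k} ((u , v) ∷ es) ((u<k , v<k) ∷ below) (suc zero) _ =
  subst (λ x → edgeDegree x (diamondEdges k ((u , v) ∷ es)) ≡ 2) (+-comm 1 k)
        (diamond-first-fresh es u<k v<k below (n≤1+n k) (n<1+n (suc k)) (incidence-right k))
diamond-fresh-degree {k} ((u , v) ∷ es) ((u<k , v<k) ∷ below) (suc (suc j)) i<2L =
  subst (λ x → edgeDegree x (diamondEdges k ((u , v) ∷ es)) ≡ 2) (sym k+2+j) (begin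
    edgeDegree x (diamondEdges k ((u , v) ∷ es))
      ≡⟨ diamond-block-fresh es u<k v<k k≤x ⟩
    2 * incidence x (k , suc k) + edgeDegree x (diamondEdges (suc (suc k)) es)
      ≡⟨ cong (λ i → 2 * i + edgeDegree x (diamondEdges (suc (suc k)) es))
              (incidence-absent (>⇒≢ k<x) (>⇒≢ k+1<x)) ⟩
    edgeDegree x (diamondEdges (suc (suc k)) es)
      ≡⟨ diamond-fresh-degree es (edgesBelow-mono (≤-trans (n≤1+n k) (n≤1+n (suc k))) below) j j<2L ⟩
    2 ∎)
  where
  x : ℕ
  x = suc (suc k) + j
  k+2+j : k + suc (suc j) ≡ x
  k+2+j = trans (+-suc k (suc j)) (cong suc (+-suc k j))
  k+1<x : suc k < x
  k+1<x = m≤m+n (suc (suc k)) j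
  k<x : k < x
  k<x = <-trans (n<1+n k) k+1<x
  k≤x : k ≤ x
  k≤x = ≤-trans (n≤1+n k) k<x
  j<2L : j < 2 * length es
  j<2L = ≤-pred (≤-pred (subst (suc (suc j) <_) (*-suc 2 (length es)) i<2L))

WellFormed : Graph → Set
WellFormed G = EdgesBelow (nv G) (edges G)

diamond : Graph → Graph
diamond G = mkGraph (nv G + 2 * length (edges G)) (diamondEdges (nv G) (edges G))

diamond-wellFormed : ∀ G → WellFormed G → WellFormed (diamond G)
diamond-wellFormed G wf = diamondEdges-below (edges G) wf ≤-refl

length-degrees : ∀ G → length (degrees G) ≡ nv G
length-degrees G = trans (length-map (degree G) (upTo (nv G))) (length-upTo (nv G))

diamond-degrees : ∀ G → WellFormed G →
  degrees (diamond G) ≡ map (2 *_) (degrees G) ++ replicate (2 * length (edges G)) 2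
diamond-degrees G wf = begin
  map d′ (upTo (N + F))
    ≡⟨ cong (map d′) (upTo-+ N F) ⟩
  map d′ (upTo N ++ map (N +_) (upTo F))
    ≡⟨ map-++ d′ (upTo N) (map (N +_) (upTo F)) ⟩
  map d′ (upTo N) ++ map d′ (map (N +_) (upTo F))
    ≡⟨ cong₂ _++_ old-part (trans (sym (map-∘ (upTo F))) fresh-part) ⟩
  map (2 *_) (degrees G) ++ replicate F 2 ∎
  where
  N F : ℕ
  N = nv G
  F = 2 * length (edges G)
  d′ : ℕ → ℕ
  d′ = degree (diamond G)
  old-part : map d′ (upTo N) ≡ map (2 *_) (degrees G)
  old-part = trans (map-cong-local (All.map (diamond-old-degree (edges G)) (all-upTo N)))
                   (map-∘ (upTo N))
  fresh-part : map (d′ ∘ (N +_)) (upTo F) ≡ replicate F 2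
  fresh-part = begin
    map (d′ ∘ (N +_)) (upTo F)
      ≡⟨ map-cong-local (All.map (diamond-fresh-degree (edges G) wf _) (all-upTo F)) ⟩
    map (λ _ → 2) (upTo F)
      ≡⟨ map-const 2 (upTo F) ⟩
    replicate (length (upTo F)) 2
      ≡⟨ cong (λ l → replicate l 2) (length-upTo F) ⟩
    replicate F 2 ∎

diamond-degree-sum : ∀ G → WellFormed G →
  sum (degrees (diamond G)) ≡ 2 * sum (degrees G) + 4 * length (edges G)
diamond-degree-sum G wf = begin
  sum (degrees (diamond G))
    ≡⟨ cong sum (diamond-degrees G wf) ⟩
  sum (map (2 *_) (degrees G) ++ replicate F 2)
    ≡⟨ sum-++ (map (2 *_) (degrees G)) (replicate F 2) ⟩
  sum (map (2 *_) (degrees G)) + sum (replicate F 2)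
    ≡⟨ cong₂ _+_ (sum-map-* 2 (degrees G)) (sum-replicate F 2) ⟩
  2 * sum (degrees G) + F * 2
    ≡⟨ cong (2 * sum (degrees G) +_) (reorder (length (edges G))) ⟩
  2 * sum (degrees G) + 4 * length (edges G) ∎
  where
  F : ℕ
  F = 2 * length (edges G)
  reorder : ∀ l → 2 * l * 2 ≡ 4 * l
  reorder = solve-∀

diamond-degree-product : ∀ G → WellFormed G →
  product (degrees (diamond G)) ≡ 2 ^ nv G * product (degrees G) * 2 ^ (2 * length (edges G))
diamond-degree-product G wf = begin
  product (degrees (diamond G))
    ≡⟨ cong product (diamond-degrees G wf) ⟩
  product (map (2 *_) (degrees G) ++ replicate F 2)
    ≡⟨ product-++ (map (2 *_) (degrees G)) (replicate F 2) ⟩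
  product (map (2 *_) (degrees G)) * product (replicate F 2)
    ≡⟨ cong₂ _*_ (product-map-* 2 (degrees G)) (product-replicate F 2) ⟩
  2 ^ length (degrees G) * product (degrees G) * 2 ^ F
    ≡⟨ cong (λ l → 2 ^ l * product (degrees G) * 2 ^ F) (length-degrees G) ⟩
  2 ^ nv G * product (degrees G) * 2 ^ F ∎
  where
  F : ℕ
  F = 2 * length (edges G)

V-wellFormed : ∀ n → WellFormed (V n)
V-wellFormed zero    = (s≤s z≤n , ≤-refl) ∷ []
V-wellFormed (suc n) = diamond-wellFormed (V n) (V-wellFormed n)

V-edges : ∀ n → length (edges (V n)) ≡ 4 ^ n
V-edges zero    = refl
V-edges (suc n) = trans (diamondEdges-length (nv (V n)) (edges (V n))) (cong (4 *_) (V-edges n))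

-- Number of vertices of V_n other than x₁, x₂.
freshCount : ℕ → ℕ
freshCount zero    = 0
freshCount (suc n) = freshCount n + 2 * 4 ^ n

V-vertices : ∀ n → nv (V n) ≡ 2 + freshCount n
V-vertices zero    = refl
V-vertices (suc n) = cong₂ (λ a l → a + 2 * l) (V-vertices n) (V-edges n)

freshCount-closed : ∀ n → 3 * freshCount n + 2 ≡ 2 * 4 ^ n
freshCount-closed zero    = refl
freshCount-closed (suc n) = begin
  3 * (freshCount n + 2 * 4 ^ n) + 2
    ≡⟨ expand (freshCount n) (4 ^ n) ⟩
  (3 * freshCount n + 2) + 6 * 4 ^ n
    ≡⟨ cong (_+ 6 * 4 ^ n) (freshCount-closed n) ⟩
  2 * 4 ^ n + 6 * 4 ^ n
    ≡⟨ collect (4 ^ n) ⟩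
  2 * (4 * 4 ^ n) ∎
  where
  expand : ∀ f p → 3 * (f + 2 * p) + 2 ≡ (3 * f + 2) + 6 * p
  expand = solve-∀
  collect : ∀ p → 2 * p + 6 * p ≡ 2 * (4 * p)
  collect = solve-∀

-- Handshake identity for V_n: the degree sum is twice the number of edges.
V-degree-sum : ∀ n → sum (degrees (V n)) ≡ 2 * 4 ^ n
V-degree-sum zero    = refl
V-degree-sum (suc n) = begin
  sum (degrees (V (suc n)))
    ≡⟨ diamond-degree-sum (V n) (V-wellFormed n) ⟩
  2 * sum (degrees (V n)) + 4 * length (edges (V n))
    ≡⟨ cong₂ (λ s l → 2 * s + 4 * l) (V-degree-sum n) (V-edges n) ⟩
  2 * (2 * 4 ^ n) + 4 * 4 ^ n
    ≡⟨ collect (4 ^ n) ⟩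
  2 * (4 * 4 ^ n) ∎
  where
  collect : ∀ p → 2 * (2 * p) + 4 * p ≡ 2 * (4 * p)
  collect = solve-∀

V-degree-product-step : ∀ n →
  product (degrees (V (suc n))) ≡ 2 ^ (2 + freshCount n) * product (degrees (V n)) * 2 ^ (2 * 4 ^ n)
V-degree-product-step n =
  trans (diamond-degree-product (V n) (V-wellFormed n))
        (cong₂ (λ a l → 2 ^ a * product (degrees (V n)) * 2 ^ (2 * l)) (V-vertices n) (V-edges n))

-- The exponent e with product = 2^e · sum for V (suc m).
ratioExponent : ℕ → ℕ
ratioExponent zero    = 1
ratioExponent (suc m) = ratioExponent m + freshCount (suc m) + 2 * 4 ^ suc m

ratioExponent-closed : ∀ m → 9 * ratioExponent m + (6 * suc m + 17) ≡ 8 * 4 ^ suc m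
ratioExponent-closed zero    = refl
ratioExponent-closed (suc m) = begin
  9 * (e + f + 2 * p) + (6 * suc (suc m) + 17)
    ≡⟨ expand e f p m ⟩
  (9 * e + (6 * suc m + 17)) + 3 * (3 * f + 2) + 18 * p
    ≡⟨ cong₂ (λ a b → a + 3 * b + 18 * p) (ratioExponent-closed m) (freshCount-closed (suc m)) ⟩
  8 * p + 3 * (2 * p) + 18 * p
    ≡⟨ collect p ⟩
  8 * (4 * p) ∎
  where
  e f p : ℕ
  e = ratioExponent m
  f = freshCount (suc m)
  p = 4 ^ suc m
  expand : ∀ e f p m → 9 * (e + f + 2 * p) + (6 * suc (suc m) + 17) ≡
                       (9 * e + (6 * suc m + 17)) + 3 * (3 * f + 2) + 18 * p
  expand = solve-∀
  collect : ∀ p → 8 * p + 3 * (2 * p) + 18 * p ≡ 8 * (4 * p)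
  collect = solve-∀

V-product-ratio : ∀ m → product (degrees (V (suc m))) ≡ 2 ^ ratioExponent m * sum (degrees (V (suc m)))
V-product-ratio zero    = refl
V-product-ratio (suc m) = begin
  product (degrees (V (suc (suc m))))
    ≡⟨ V-degree-product-step (suc m) ⟩
  2 ^ (2 + f) * product (degrees (V (suc m))) * 2 ^ (2 * p)
    ≡⟨ cong (λ q → 2 ^ (2 + f) * q * 2 ^ (2 * p))
            (trans (V-product-ratio m) (cong (2 ^ e *_) (V-degree-sum (suc m)))) ⟩
  2 ^ (2 + f) * (2 ^ e * (2 * p)) * 2 ^ (2 * p)
    ≡⟨ regroup (2 ^ f) (2 ^ e) p (2 ^ (2 * p)) ⟩
  2 ^ e * 2 ^ f * 2 ^ (2 * p) * (2 * (4 * p))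
    ≡⟨ cong₂ _*_ (sym split) (sym (V-degree-sum (suc (suc m)))) ⟩
  2 ^ (e + f + 2 * p) * sum (degrees (V (suc (suc m)))) ∎
  where
  e f p : ℕ
  e = ratioExponent m
  f = freshCount (suc m)
  p = 4 ^ suc m
  regroup : ∀ a b p q → 2 * (2 * a) * (b * (2 * p)) * q ≡ b * a * q * (2 * (4 * p))
  regroup = solve-∀
  split : 2 ^ (e + f + 2 * p) ≡ 2 ^ e * 2 ^ f * 2 ^ (2 * p)
  split = trans (^-distribˡ-+-* 2 (e + f) (2 * p)) (cong (_* 2 ^ (2 * p)) (^-distribˡ-+-* 2 e f))

two-four-pow : ∀ n → 2 * 4 ^ (n + 1) ≡ 8 * 4 ^ n
two-four-pow n = trans (cong (λ k → 2 * 4 ^ k) (+-comm n 1)) (assoc (4 ^ n))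
  where
  assoc : ∀ p → 2 * (4 * p) ≡ 8 * p
  assoc = solve-∀

corollary5p10 : (n : ℕ) → 1 ≤ n →
    Σ ℕ (λ e → (9 * e + (6 * n + 17) ≡ 2 * 4 ^ (n + 1))
    × (product (degrees (V n)) ≡ 2 ^ e * sum (degrees (V n))))
corollary5p10 zero    ()
corollary5p10 (suc m) _ =
    ratioExponent m
  , trans (ratioExponent-closed m) (sym (two-four-pow (suc m)))
  , V-product-ratio m
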